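{- There exists an algorithm (in the exploration model described in the context) that successfully explores all finite connected graphs and that, on every graph with $n$ vertices, uses at most $n-1$ colors.
   Context: Exploration model. Graphs are finite, simple, undirected and connected; vertices are anonymous and edges carry no port labels. Each vertex carries a color in $\mathbb{N}=\{0,1,2,\dots\}$, where $0$ means "uncolored"; initially all vertices have color $0$. An algorithm is a function $\mathrm{move}$ mapping every environment $(c_0,E)$ — where $c_0\in\mathbb{N}$ is the color of the agent's current vertex and $E:\mathbb{N}\to\mathbb{N}$ (zero almost everywhere) gives, for each color $c$, the number $E(c)$ of neighbors of the current vertex having color $c$ — either to $\mathrm{Stop}$ or to a pair $(c_1,d)\in\mathbb{N}\times\mathbb{N}$ with $E(d)>0$, subject to $c_1=c_0$ whenever $c_0\neq 0$ (a vertex may only be colored while it is uncolored). A run on a graph $G$: an adversary chooses a start vertex $v_0$ and places the agent there; in each step, with the agent at $v$, $\mathrm{move}$ is evaluated at the environment of $v$; if the value is $\mathrm{Stop}$ the run ends, and if it is $(c_1,d)$ then $v$ receives color $c_1$ and the adversary chooses an arbitrary neighbor of $v$ of color $d$, to which the agent moves. The agent has no other memory. A vertex is visited if the agent is located at it in some step. An algorithm successfully explores $G$ if for every adversary (every choice of start vertex and of neighbors), after finitely many steps all vertices have been visited, the agent is at $v_0$, and the decision is $\mathrm{Stop}$. The number of colors used in a run is the number of distinct nonzero colors assigned during the run; the algorithm uses at most $m$ colors on $G$ if every run on $G$ (for every adversary) uses at most $m$ colors. -}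

module Defs where

open import Data.Nat using (ℕ; zero; suc; _<_; _≤_; _⊔_; _≡ᵇ_)
open import Data.Bool using (Bool; true; false; if_then_else_; _∧_; not)
open import Data.Fin using (Fin)
open import Data.Fin.Properties using () renaming (_≟_ to _≟ᶠ_)
open import Data.List using (List; []; _∷_; length; map; foldr; filterᵇ; dropWhileᵇ; reverse; upTo; allFin; deduplicateᵇ)
open import Data.Product using (_×_; Σ)
open import Data.Unit using (⊤)
open import Relation.Binary.PropositionalEquality using (_≡_; _≢_)
open import Relation.Nullary.Decidable using (⌊_⌋)

-- The finitely supported function E : ℕ → ℕ is
-- represented by the list of its values [E 0 , E 1 , … , E k] (the
-- environments produced by a graph carry no trailing zeros, see envAt).
record Env : Set where
  constructor env
  field
    here   : ℕ        -- c₀, colour of the current vertex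
    counts : List ℕ

countOf : List ℕ → ℕ → ℕ
countOf []       _       = 0
countOf (x ∷ xs) zero    = x
countOf (x ∷ xs) (suc c) = countOf xs c

data Decision : Set where
  Stop : Decision
  Go   : (c₁ d : ℕ) → Decision     -- colour current vertex c₁, move to a neighbour of colour d

ValidDecision : Env → Decision → Set
ValidDecision e          Stop       = ⊤
ValidDecision (env c₀ E) (Go c₁ d)  = (0 < countOf E d) × (c₀ ≢ 0 → c₁ ≡ c₀)

record Algorithm : Set where
  field
    move  : Env → Decision
    valid : ∀ e → ValidDecision e (move e)
open Algorithm public

record Graph (n : ℕ) : Set where
  field
    adj    : Fin n → Fin n → Bool
    sym    : ∀ u v → adj u v ≡ adj v u
    irrefl : ∀ v → adj v v ≡ false
open Graph public

data Reach {n : ℕ} (G : Graph n) : Fin n → Fin n → Set where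
  here : ∀ {v} → Reach G v v
  edge : ∀ {u w v} → adj G u w ≡ true → Reach G w v → Reach G u v

Connected : {n : ℕ} → Graph n → Set
Connected G = ∀ u v → Reach G u v

Coloring : ℕ → Set
Coloring n = Fin n → ℕ

update : {n : ℕ} → Coloring n → Fin n → ℕ → Coloring n
update col v c u = if ⌊ u ≟ᶠ v ⌋ then c else col u

mark : {n : ℕ} → (Fin n → Bool) → Fin n → (Fin n → Bool)
mark vis v u = if ⌊ u ≟ᶠ v ⌋ then true else vis u

nbCount : {n : ℕ} → Graph n → Coloring n → Fin n → ℕ → ℕ
nbCount {n} G col v c = length (filterᵇ (λ u → adj G v u ∧ (col u ≡ᵇ c)) (allFin n))

maxColor : {n : ℕ} → Coloring n → ℕ
maxColor {n} col = foldr _⊔_ 0 (map col (allFin n))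

stripZeros : List ℕ → List ℕ
stripZeros xs = reverse (dropWhileᵇ (λ x → x ≡ᵇ 0) (reverse xs))

envAt : {n : ℕ} → Graph n → Coloring n → Fin n → Env
envAt G col v = env (col v) (stripZeros (map (nbCount G col v) (upTo (suc (maxColor col)))))

usedColors : {n : ℕ} → Coloring n → ℕ
usedColors {n} col =
  length (deduplicateᵇ _≡ᵇ_ (filterᵇ (λ c → not (c ≡ᵇ 0)) (map col (allFin n))))

uncolored : {n : ℕ} → Coloring n
uncolored _ = 0

-- Every run from the configuration (colouring col, visited set vis,
-- agent at v) is finite (whatever the adversary does) and ends with the
-- decision Stop, with all vertices visited and the agent back at v₀.
data GoodFrom {n : ℕ} (A : Algorithm) (G : Graph n) (v₀ : Fin n)
     : Coloring n → (Fin n → Bool) → Fin n → Set where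
  done : ∀ {col vis v} →
         move A (envAt G col v) ≡ Stop →
         (∀ u → vis u ≡ true) → v ≡ v₀ →
         GoodFrom A G v₀ col vis v
  step : ∀ {col vis v c₁ d} →
         move A (envAt G col v) ≡ Go c₁ d →
         (∀ u → adj G v u ≡ true → update col v c₁ u ≡ d →
                GoodFrom A G v₀ (update col v c₁) (mark vis u) u) →
         GoodFrom A G v₀ col vis v

SuccessfullyExplores : Algorithm → {n : ℕ} → Graph n → Set
SuccessfullyExplores A {n} G =
  ∀ (v₀ : Fin n) → GoodFrom A G v₀ uncolored (mark (λ _ → false) v₀) v₀

data Reachable {n : ℕ} (A : Algorithm) (G : Graph n) (v₀ : Fin n)
     : Coloring n → Fin n → Set where
  start : Reachable A G v₀ uncolored v₀
  step  : ∀ {col v c₁ d u} → Reachable A G v₀ col v →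
          move A (envAt G col v) ≡ Go c₁ d →
          adj G v u ≡ true → update col v c₁ u ≡ d →
          Reachable A G v₀ (update col v c₁) u

UsesAtMost : Algorithm → {n : ℕ} → Graph n → ℕ → Set
UsesAtMost A {n} G m =
  ∀ (v₀ : Fin n) col v → Reachable A G v₀ col v → usedColors col ≤ m

-- Depth-first search with the stack stored in the colours.  A vertex of
-- colour c without uncoloured neighbours returns to its neighbour of
-- colour c - 1, which is its parent because a finished vertex adjacent to
-- the stack is never shallower than the stack vertex it touches.  The
-- search stops on the root once the root has no uncoloured neighbour, and
-- the coloured set, being closed under adjacency, is then the whole
-- connected graph.  A vertex is pushed at depth d only while it and some
-- other vertex are still uncoloured, so d + 1 ≤ n.  Every move lowers
-- 2 · (number of uncoloured vertices) + (stack height) + (1 if the agent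
-- stands on the stack).

module Submission where

open import Defs renaming (sym to adj-sym)
open import Data.Bool using (Bool; true; T; _∧_; not)
open import Data.Bool.Properties using (T-∧; T-≡)
open import Data.Empty using (⊥-elim)
open import Data.Fin using (Fin)
open import Data.Fin.Properties using () renaming (_≟_ to _≟ᶠ_)
open import Data.List
  using (List; []; _∷_; _++_; length; map; filter; filterᵇ; reverse; takeWhile; dropWhile;
         applyUpTo; upTo; allFin; deduplicateᵇ)
open import Data.List.Properties
  using (filter-some; filter-none; filter-notAll; filter-≐; length-filter; length-tabulate;
         length-applyUpTo; map-upTo; takeWhile++dropWhile; reverse-++; reverse-involutive;
         foldr-preservesᵒ)
open import Data.List.Membership.Propositional using (_∈_; _∉_)
open import Data.List.Membership.Propositional.Properties
  using (∈-allFin; ∈-filter⁺; ∈-filter⁻; ∈-map⁻; ∈-deduplicate⁻; ∈-applyUpTo⁺)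
open import Data.List.Relation.Unary.All as All using (All; []; _∷_)
open import Data.List.Relation.Unary.All.Properties using (all-takeWhile; all-filter; tabulate⁺)
open import Data.List.Relation.Unary.Any as Any using (Any; here; there)
open import Data.List.Relation.Unary.Any.Properties using (reverse⁻; map⁺)
open import Data.List.Relation.Unary.Unique.Propositional using (Unique; []; _∷_)
import Data.List.Relation.Unary.Unique.Propositional.Properties as Unique
import Data.List.Relation.Binary.Sublist.Propositional as Sublist
import Data.List.Relation.Binary.Sublist.Propositional.Properties as Sublist
open import Data.Nat
open import Data.Nat.Properties
open import Data.Product using (Σ; Σ-syntax; ∃-syntax; _×_; _,_; proj₁; proj₂)
open import Data.Sum using (_⊎_; inj₁; inj₂; [_,_])
open import Data.Unit using (⊤; tt)
open import Function using (_∘_; Equivalence)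
open import Relation.Binary.Definitions using (DecidableEquality)
open import Relation.Binary.PropositionalEquality
  using (_≡_; _≢_; refl; sym; trans; cong; cong₂; subst; subst₂; _≗_; module ≡-Reasoning)
open import Relation.Nullary using (¬_; yes; no; ¬?)
open import Relation.Nullary.Decidable using (T?)
open import Relation.Unary using (Pred; Decidable; _⊆_)
open import Level using (0ℓ)

countOf-++-zeros : ∀ xs {zs} → All (_≡ 0) zs → ∀ d → countOf (xs ++ zs) d ≡ countOf xs d
countOf-++-zeros []       []          d       = refl
countOf-++-zeros []       (z≡0 ∷ _)   zero    = z≡0
countOf-++-zeros []       (_ ∷ zs≡0)  (suc d) = countOf-++-zeros [] zs≡0 d
countOf-++-zeros (x ∷ xs) zs≡0        zero    = refl
countOf-++-zeros (x ∷ xs) zs≡0        (suc d) = countOf-++-zeros xs zs≡0 d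

stripZeros-++-zeros : ∀ xs → ∃[ zs ] All (_≡ 0) zs × stripZeros xs ++ zs ≡ xs
stripZeros-++-zeros xs = reverse zeros , All.tabulate (λ z∈ → All.lookup trailing (reverse⁻ z∈)) , (begin
    reverse rest ++ reverse zeros  ≡⟨ reverse-++ zeros rest ⟨
    reverse (zeros ++ rest)        ≡⟨ cong reverse (takeWhile++dropWhile isZero? (reverse xs)) ⟩
    reverse (reverse xs)           ≡⟨ reverse-involutive xs ⟩
    xs                             ∎)
  where
  open ≡-Reasoning
  isZero? = λ x → T? (x ≡ᵇ 0)
  zeros = takeWhile isZero? (reverse xs)
  rest  = dropWhile isZero? (reverse xs)
  trailing : All (_≡ 0) zeros
  trailing = All.map (≡ᵇ⇒≡ _ 0) (all-takeWhile isZero? (reverse xs))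

countOf-stripZeros : ∀ xs d → countOf (stripZeros xs) d ≡ countOf xs d
countOf-stripZeros xs d with stripZeros-++-zeros xs
... | zs , zs≡0 , split = trans (sym (countOf-++-zeros (stripZeros xs) zs≡0 d)) (cong (λ ys → countOf ys d) split)

countOf-applyUpTo-< : ∀ (f : ℕ → ℕ) {k d} → d < k → countOf (applyUpTo f k) d ≡ f d
countOf-applyUpTo-< f {suc k} {zero}  _         = refl
countOf-applyUpTo-< f {suc k} {suc d} (s≤s d<k) = countOf-applyUpTo-< (f ∘ suc) d<k

countOf-applyUpTo-≥ : ∀ (f : ℕ → ℕ) {k d} → k ≤ d → countOf (applyUpTo f k) d ≡ 0
countOf-applyUpTo-≥ f {zero}          _         = refl
countOf-applyUpTo-≥ f {suc k} {suc d} (s≤s k≤d) = countOf-applyUpTo-≥ (f ∘ suc) k≤d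

trimmedLength : List ℕ → ℕ
trimmedLength []       = 0
trimmedLength (x ∷ xs) = extend x (trimmedLength xs)
  where
  extend : ℕ → ℕ → ℕ
  extend _       (suc t) = suc (suc t)
  extend zero    zero    = 0
  extend (suc _) zero    = 1

trimmedLength-last : ∀ xs {t} → trimmedLength xs ≡ suc t → 0 < countOf xs t
trimmedLength-last (x ∷ xs) {t} eq with trimmedLength xs in eq′
trimmedLength-last (x ∷ xs)     {suc t} refl | suc .t = trimmedLength-last xs eq′
trimmedLength-last (suc x ∷ xs) {zero}  refl | zero   = z<s

trimmedLength-bound : ∀ xs {i} → 0 < countOf xs i → i < trimmedLength xs
trimmedLength-bound (x ∷ xs) {zero} pos with trimmedLength xs
trimmedLength-bound (suc x ∷ xs) {zero} pos | zero  = z<s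
trimmedLength-bound (x ∷ xs)     {zero} pos | suc t = z<s
trimmedLength-bound (x ∷ xs) {suc i} pos with trimmedLength xs | trimmedLength-bound xs pos
... | suc t | i<t = s≤s i<t

-- The largest nonzero colour d with E(d) > 0, or 0 if there is none.
maxColorIn : List ℕ → ℕ
maxColorIn []      = 0
maxColorIn (_ ∷ E) = trimmedLength E

maxColorIn-present : ∀ E {m} → maxColorIn E ≡ suc m → 0 < countOf E (suc m)
maxColorIn-present (_ ∷ E) = trimmedLength-last E

maxColorIn-maximal : ∀ E {i} → 0 < countOf E (suc i) → suc i ≤ maxColorIn E
maxColorIn-maximal (_ ∷ E) = trimmedLength-bound E

maxColorIn-least : ∀ E {k} → (∀ {i} → 0 < countOf E (suc i) → suc i ≤ k) → maxColorIn E ≤ k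
maxColorIn-least E bound with maxColorIn E in m≡
... | zero  = z≤n
... | suc _ = bound (maxColorIn-present E m≡)

-- A vertex left forward is coloured with its depth
-- on the search stack, a leaf with the depth of its parent; from a
-- finished vertex of colour c the agent returns along the colour c - 1.
dfsDecision : (own uncoloredNbrs maxNbrColor parentNbrs : ℕ) → Decision
dfsDecision zero          (suc _) m       _       = Go (suc m) 0
dfsDecision zero          zero    zero    _       = Stop
dfsDecision zero          zero    (suc m) _       = Go (suc m) (suc m)
dfsDecision (suc c)       (suc _) _       _       = Go (suc c) 0
dfsDecision (suc zero)    zero    _       _       = Stop
dfsDecision (suc (suc c)) zero    _       zero    = Stop
dfsDecision (suc (suc c)) zero    _       (suc _) = Go (suc (suc c)) (suc c)

dfsMove : Env → Decision
dfsMove (env c E) = dfsDecision c (countOf E 0) (maxColorIn E) (countOf E (pred c))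

≡suc⇒pos : ∀ {x y} → x ≡ suc y → 0 < x
≡suc⇒pos refl = z<s

≡suc⇒≢0 : ∀ {x y} → x ≡ suc y → x ≢ 0
≡suc⇒≢0 refl ()

dfsMove-valid : ∀ e → ValidDecision e (dfsMove e)
dfsMove-valid (env zero E) with countOf E 0 in a≡ | maxColorIn E in m≡
... | suc _ | _     = ≡suc⇒pos a≡ , λ 0≢0 → ⊥-elim (0≢0 refl)
... | zero  | zero  = tt
... | zero  | suc _ = maxColorIn-present E m≡ , λ 0≢0 → ⊥-elim (0≢0 refl)
dfsMove-valid (env (suc c) E) with countOf E 0 in a≡
... | suc _ = ≡suc⇒pos a≡ , λ _ → refl
dfsMove-valid (env (suc zero) E) | zero = tt
dfsMove-valid (env (suc (suc c)) E) | zero with countOf E (suc c) in b≡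
... | zero  = tt
... | suc _ = ≡suc⇒pos b≡ , λ _ → refl

dfs : Algorithm
dfs = record { move = dfsMove ; valid = dfsMove-valid }

module _ {A : Set} {P Q : Pred A 0ℓ} (P? : Decidable P) (Q? : Decidable Q) where

  length-filter-mono : P ⊆ Q → ∀ xs → length (filter P? xs) ≤ length (filter Q? xs)
  length-filter-mono P⊆Q xs =
    Sublist.length-mono-≤ (Sublist.filter⁺ P? Q? (λ { refl → P⊆Q }) (Sublist.⊆-refl {x = xs}))

  length-filter-< : P ⊆ Q → ∀ {x xs} → x ∈ xs → ¬ P x → Q x →
                    length (filter P? xs) < length (filter Q? xs)
  length-filter-< P⊆Q {xs = y ∷ ys} (here refl) ¬Py Qy with P? y | Q? y
  ... | yes Py | _      = ⊥-elim (¬Py Py)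
  ... | no _   | yes _  = s≤s (length-filter-mono P⊆Q ys)
  ... | no _   | no ¬Qy = ⊥-elim (¬Qy Qy)
  length-filter-< P⊆Q {xs = y ∷ ys} (there x∈ys) ¬Px Qx with P? y | Q? y
  ... | yes Py | yes _  = s≤s (length-filter-< P⊆Q x∈ys ¬Px Qx)
  ... | yes Py | no ¬Qy = ⊥-elim (¬Qy (P⊆Q Py))
  ... | no _   | yes _  = m≤n⇒m≤1+n (length-filter-< P⊆Q x∈ys ¬Px Qx)
  ... | no _   | no _   = length-filter-< P⊆Q x∈ys ¬Px Qx

filter-some⁻ : ∀ {A : Set} {P : Pred A 0ℓ} (P? : Decidable P) xs → 0 < length (filter P? xs) → Any P xs
filter-some⁻ P? (x ∷ xs) pos with P? x
... | yes Px = here Px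
... | no _   = there (filter-some⁻ P? xs pos)

length-≤-Unique : ∀ {A : Set} → DecidableEquality A → ∀ {xs ys : List A} →
                  Unique xs → (∀ {x} → x ∈ xs → x ∈ ys) → length xs ≤ length ys
length-≤-Unique _≟_ {[]}     _               _      = z≤n
length-≤-Unique _≟_ {x ∷ xs} {ys} (x∉xs ∷ xs!) xs⊆ys = begin-strict
    length xs               ≤⟨ length-≤-Unique _≟_ xs! xs⊆ys-x ⟩
    length (filter ≢x? ys)  <⟨ filter-notAll ≢x? ys x∈ys ⟩
    length ys               ∎
  where
  open ≤-Reasoning
  ≢x? = λ y → ¬? (y ≟ x)
  x∈ys : Any (λ y → ¬ y ≢ x) ys
  x∈ys = Any.map (λ { refl ≢x → ≢x refl }) (xs⊆ys (here refl))
  xs⊆ys-x : ∀ {z} → z ∈ xs → z ∈ filter ≢x? ys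
  xs⊆ys-x z∈xs = ∈-filter⁺ ≢x? (xs⊆ys (there z∈xs)) (λ z≡x → All.lookup x∉xs z∈xs (sym z≡x))

Unique-deduplicateᵇ : ∀ xs → Unique (deduplicateᵇ _≡ᵇ_ xs)
Unique-deduplicateᵇ []       = []
Unique-deduplicateᵇ (x ∷ xs) =
  All.map (λ x≢ᵇy x≡y → x≢ᵇy (≡⇒≡ᵇ x _ x≡y)) (all-filter x≢ᵇ? rest) ∷
  Unique.filter⁺ x≢ᵇ? (Unique-deduplicateᵇ xs)
  where
  rest = deduplicateᵇ _≡ᵇ_ xs
  x≢ᵇ? = λ y → ¬? (T? (x ≡ᵇ y))

usedColors-≤ : ∀ {n} (col : Coloring n) {m} → (∀ w → col w ≤ m) → usedColors col ≤ m
usedColors-≤ {n} col {m} col≤m = begin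
    usedColors col             ≤⟨ length-≤-Unique _≟_ (Unique-deduplicateᵇ _) colors⊆ ⟩
    length (applyUpTo suc m)   ≡⟨ length-applyUpTo suc m ⟩
    m                          ∎
  where
  open ≤-Reasoning
  nonzero = filterᵇ (λ c → not (c ≡ᵇ 0)) (map col (allFin n))
  colors⊆ : ∀ {c} → c ∈ deduplicateᵇ _≡ᵇ_ nonzero → c ∈ applyUpTo suc m
  colors⊆ c∈
    with ∈-filter⁻ (T? ∘ λ c → not (c ≡ᵇ 0)) {xs = map col (allFin n)} (∈-deduplicate⁻ _ _ c∈)
  colors⊆ {suc c} _ | c∈cols , _ with ∈-map⁻ col {xs = allFin n} c∈cols
  ... | w , _ , c≡ = ∈-applyUpTo⁺ suc (subst (_≤ m) (sym c≡) (col≤m w))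

<⇒≤∸1 : ∀ {m n} → m < n → m ≤ n ∸ 1
<⇒≤∸1 (s≤s m≤n) = m≤n

potential-drop : ∀ {u′ u} s → suc u′ ≤ u → 2 * u′ + suc s < 2 * u + s
potential-drop {u′} {u} s u′<u = begin-strict
    2 * u′ + suc s      ≡⟨ +-suc (2 * u′) s ⟩
    suc (2 * u′ + s)    <⟨ n<1+n _ ⟩
    2 + 2 * u′ + s      ≡⟨ cong (_+ s) (*-suc 2 u′) ⟨
    2 * suc u′ + s      ≤⟨ +-monoˡ-≤ s (*-monoʳ-≤ 2 u′<u) ⟩
    2 * u + s           ∎
  where open ≤-Reasoning

module _ {n : ℕ} where

  update-same : ∀ (col : Coloring n) v c → update col v c v ≡ c
  update-same col v c with v ≟ᶠ v
  ... | yes _   = refl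
  ... | no v≢v = ⊥-elim (v≢v refl)

  update-other : ∀ (col : Coloring n) {v} c {w} → w ≢ v → update col v c w ≡ col w
  update-other col {v} c {w} w≢v with w ≟ᶠ v
  ... | yes w≡v = ⊥-elim (w≢v w≡v)
  ... | no _    = refl

  update-id : ∀ (col : Coloring n) {v c} → col v ≡ c → col ≗ update col v c
  update-id col {v} col-v≡c w with w ≟ᶠ v
  ... | yes refl = col-v≡c
  ... | no _     = refl

  update-colored : ∀ (col : Coloring n) v k {w} → col w ≢ 0 → update col v (suc k) w ≢ 0
  update-colored col v k {w} col-w≢0 with w ≟ᶠ v
  ... | yes _ = λ ()
  ... | no _  = col-w≢0

  mark-same : ∀ (vis : Fin n → Bool) v → mark vis v v ≡ true
  mark-same vis v with v ≟ᶠ v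
  ... | yes _   = refl
  ... | no v≢v = ⊥-elim (v≢v refl)

  mark-mono : ∀ (vis : Fin n → Bool) v {w} → vis w ≡ true → mark vis v w ≡ true
  mark-mono vis v {w} vis-w with w ≟ᶠ v
  ... | yes _ = refl
  ... | no _  = vis-w

  color-≤-maxColor : ∀ (col : Coloring n) w → col w ≤ maxColor col
  color-≤-maxColor col w =
    foldr-preservesᵒ {P = col w ≤_} {f = _⊔_} (λ x y → [ m≤n⇒m≤n⊔o y , m≤n⇒m≤o⊔n x ])
      0 (map col (allFin n)) (inj₂ (map⁺ (Any.map (λ { refl → ≤-refl }) (∈-allFin w))))

  uncoloredCount : Coloring n → ℕ
  uncoloredCount col = length (filter (λ w → col w ≟ 0) (allFin n))

  uncoloredCount-≤ : ∀ col → uncoloredCount col ≤ n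
  uncoloredCount-≤ col = ≤-trans (length-filter _ (allFin n)) (≤-reflexive (length-tabulate _))

  uncoloredCount-cong : ∀ {col col′} → col ≗ col′ → uncoloredCount col ≡ uncoloredCount col′
  uncoloredCount-cong col≗col′ =
    cong length (filter-≐ _ _ ((λ {w} → trans (sym (col≗col′ w))) , (λ {w} → trans (col≗col′ w))) (allFin n))

  uncoloredCount-pos : ∀ col {w} → col w ≡ 0 → 0 < uncoloredCount col
  uncoloredCount-pos col col-w≡0 = filter-some (λ w → col w ≟ 0) (Any.map (λ { refl → col-w≡0 }) (∈-allFin _))

  uncoloredCount-update : ∀ col {v} k → col v ≡ 0 → uncoloredCount (update col v (suc k)) < uncoloredCount col
  uncoloredCount-update col {v} k col-v≡0 =
    length-filter-< (λ w → update col v (suc k) w ≟ 0) (λ w → col w ≟ 0) stays-uncolored (∈-allFin v)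
      (λ v-uncolored → 1+n≢0 (trans (sym (update-same col v (suc k))) v-uncolored)) col-v≡0
    where
    stays-uncolored : ∀ {w} → update col v (suc k) w ≡ 0 → col w ≡ 0
    stays-uncolored {w} w-uncolored with w ≟ᶠ v
    ... | no _ = w-uncolored

module _ {n : ℕ} (G : Graph n) where

  adj⇒≢ : ∀ {v w} → adj G v w ≡ true → w ≢ v
  adj⇒≢ {v} v-v refl with trans (sym v-v) (irrefl G v)
  ... | ()

  adj-flip : ∀ {v w} → adj G v w ≡ true → adj G w v ≡ true
  adj-flip {v} {w} v-w = trans (adj-sym G w v) v-w

  update-nbr : ∀ (col : Coloring n) {v c u} → adj G v u ≡ true → update col v c u ≡ col u
  update-nbr col v-u = update-other col _ (adj⇒≢ v-u)

  Reach-closed : (P : Fin n → Set) → (∀ {x y} → P x → adj G x y ≡ true → P y) →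
                 ∀ {u w} → Reach G u w → P u → P w
  Reach-closed P closed here           Pu = Pu
  Reach-closed P closed (edge u-x path) Pu = Reach-closed P closed path (closed Pu u-x)

  nbCount-pos : ∀ col {v w c} → adj G v w ≡ true → col w ≡ c → 0 < nbCount G col v c
  nbCount-pos col {v} {w} {c} v-w refl =
    filter-some _ (Any.map (λ { refl → subst (λ b → T (b ∧ (col w ≡ᵇ col w))) (sym v-w) (≡⇒≡ᵇ (col w) _ refl) })
                           (∈-allFin w))

  nbCount-zero : ∀ col {v w c} → nbCount G col v c ≡ 0 → adj G v w ≡ true → col w ≢ c
  nbCount-zero col none v-w col-w≡c = <⇒≢ (nbCount-pos col v-w col-w≡c) (sym none)

  nbCount-witness : ∀ col {v c} → 0 < nbCount G col v c → ∃[ w ] adj G v w ≡ true × col w ≡ c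
  nbCount-witness col {v} {c} pos with Any.satisfied (filter-some⁻ _ (allFin n) pos)
  ... | w , found with Equivalence.to T-∧ found
  ...   | v-w , col-w≡c = w , Equivalence.to T-≡ v-w , ≡ᵇ⇒≡ (col w) c col-w≡c

  nbCount-beyond : ∀ col {v d} → maxColor col < d → nbCount G col v d ≡ 0
  nbCount-beyond col {v} {d} max<d =
    cong length (filter-none _ (tabulate⁺ λ w found →
      <⇒≢ (≤-<-trans (color-≤-maxColor col w) max<d)
          (≡ᵇ⇒≡ (col w) d (proj₂ (Equivalence.to T-∧ found)))))

  envCounts : Coloring n → Fin n → List ℕ
  envCounts col v = Env.counts (envAt G col v)

  countOf-envAt : ∀ col v d → countOf (envCounts col v) d ≡ nbCount G col v d
  countOf-envAt col v d = begin
      countOf (stripZeros (map counts (upTo k))) d  ≡⟨ countOf-stripZeros (map counts (upTo k)) d ⟩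
      countOf (map counts (upTo k)) d               ≡⟨ cong (λ xs → countOf xs d) (map-upTo counts k) ⟩
      countOf (applyUpTo counts k) d                ≡⟨ read ⟩
      counts d                                      ∎
    where
    open ≡-Reasoning
    k = suc (maxColor col)
    counts = nbCount G col v
    read : countOf (applyUpTo counts k) d ≡ counts d
    read with d <? k
    ... | yes d<k = countOf-applyUpTo-< counts d<k
    ... | no d≮k  = trans (countOf-applyUpTo-≥ counts (≮⇒≥ d≮k)) (sym (nbCount-beyond col (≮⇒≥ d≮k)))

module DepthFirstSearch {n : ℕ} (G : Graph n) (v₀ : Fin n) where

  open import Data.List.Membership.DecPropositional (_≟ᶠ_ {n}) using (_∈?_)

  Stack : Set
  Stack = List (Fin n)

  RestsOn : Fin n → Stack → Set
  RestsOn s []      = s ≡ v₀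
  RestsOn s (t ∷ _) = adj G s t ≡ true

  -- Stacks are listed top first; the vertex at depth i has colour i.
  IsStack : Coloring n → Stack → Set
  IsStack col []      = ⊤
  IsStack col (s ∷ S) = col s ≡ suc (length S) × IsStack col S × RestsOn s S

  IsStack-colors : ∀ {col} S → IsStack col S → ∀ {w} → w ∈ S → 0 < col w × col w ≤ length S
  IsStack-colors (s ∷ S) (col-s , _ , _) (here refl) = ≡suc⇒pos col-s , ≤-reflexive col-s
  IsStack-colors (s ∷ S) (_ , S-ok , _)  (there w∈S) with IsStack-colors S S-ok w∈S
  ... | pos , ≤len = pos , m≤n⇒m≤1+n ≤len

  IsStack-top : ∀ {col s} S → IsStack col (s ∷ S) →
                ∀ {w} → w ∈ s ∷ S → col w ≡ suc (length S) → w ≡ s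
  IsStack-top S _            (here refl) _      = refl
  IsStack-top S (_ , S-ok , _) (there w∈S) col-w with IsStack-colors S S-ok w∈S
  ... | _ , ≤len = ⊥-elim (<-irrefl refl (subst (_≤ length S) col-w ≤len))

  IsStack-cong : ∀ {col col′} S → (∀ {w} → w ∈ S → col w ≡ col′ w) → IsStack col S → IsStack col′ S
  IsStack-cong []      _     _                         = tt
  IsStack-cong (s ∷ S) agree (col-s , S-ok , s-rests) =
    trans (sym (agree (here refl))) col-s , IsStack-cong S (agree ∘ there) S-ok , s-rests

  Entering : Coloring n → Stack → Fin n → Set
  Entering col []      v = (∀ w → col w ≡ 0) × v ≡ v₀
  Entering col (t ∷ _) v = adj G t v ≡ true

  Entering⇒RestsOn : ∀ {col v} S → Entering col S v → RestsOn v S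
  Entering⇒RestsOn []      (_ , v≡v₀) = v≡v₀
  Entering⇒RestsOn (t ∷ S) t-v        = adj-flip G t-v

  Finished : Coloring n → Stack → Fin n → Set
  Finished col S w = col w ≢ 0 × w ∉ S

  -- `below` makes the neighbour of colour c - 1 of a stack vertex of
  -- colour c its parent: finished vertices cannot have that colour.
  record Invariant (col : Coloring n) (S : Stack) : Set where
    field
      stack   : IsStack col S
      closed  : ∀ {w x} → Finished col S w → adj G w x ≡ true → col x ≢ 0
      below   : ∀ {w s} → Finished col S w → s ∈ S → adj G w s ≡ true → col s ≤ col w
      size    : length S + uncoloredCount col ≤ n
      bounded : ∀ w → col w ≤ n ∸ 1
  open Invariant

  top-color : ∀ {col v S} → Invariant col (v ∷ S) → col v ≡ suc (length S)
  top-color inv = proj₁ (stack inv)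

  rest-IsStack : ∀ {col v S} → Invariant col (v ∷ S) → IsStack col S
  rest-IsStack inv = proj₁ (proj₂ (stack inv))

  top-RestsOn : ∀ {col v S} → Invariant col (v ∷ S) → RestsOn v S
  top-RestsOn inv = proj₂ (proj₂ (stack inv))

  coloredNbr-onStack : ∀ {col S v w} → Invariant col S → col v ≡ 0 → adj G v w ≡ true → col w ≢ 0 → w ∈ S
  coloredNbr-onStack {S = S} {w = w} inv col-v≡0 v-w col-w≢0 with w ∈? S
  ... | yes w∈S = w∈S
  ... | no w∉S  = ⊥-elim (closed inv (col-w≢0 , w∉S) (adj-flip G v-w) col-v≡0)

  update-misses-stack : ∀ {col S v} → Invariant col S → col v ≡ 0 →
                        ∀ c {w} → w ∈ S → col w ≡ update col v c w
  update-misses-stack {col} {S} inv col-v≡0 c w∈S =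
    sym (update-other col c λ { refl → <⇒≢ (proj₁ (IsStack-colors S (stack inv) w∈S)) (sym col-v≡0) })

  Invariant-cong : ∀ {col col′ S} → col ≗ col′ → Invariant col S → Invariant col′ S
  Invariant-cong {col} {col′} {S} col≗col′ inv = record
    { stack   = IsStack-cong S (λ {w} _ → col≗col′ w) (stack inv)
    ; closed  = λ (col′-w≢0 , w∉S) w-x → colored′ (closed inv (colored col′-w≢0 , w∉S) w-x)
    ; below   = λ {w} {s} (col′-w≢0 , w∉S) s∈S w-s →
                  subst₂ _≤_ (col≗col′ s) (col≗col′ w) (below inv (colored col′-w≢0 , w∉S) s∈S w-s)
    ; size    = subst (λ k → length S + k ≤ n) (uncoloredCount-cong col≗col′) (size inv)
    ; bounded = λ w → subst (_≤ n ∸ 1) (col≗col′ w) (bounded inv w)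
    }
    where
    colored : ∀ {w} → col′ w ≢ 0 → col w ≢ 0
    colored {w} = subst (_≢ 0) (sym (col≗col′ w))
    colored′ : ∀ {w} → col w ≢ 0 → col′ w ≢ 0
    colored′ {w} = subst (_≢ 0) (col≗col′ w)

  pop-invariant : ∀ {col v p S} → Invariant col (v ∷ p ∷ S) → nbCount G col v 0 ≡ 0 → Invariant col (p ∷ S)
  pop-invariant {col} {v} {p} {S} inv v-done = record
    { stack   = rest-IsStack inv
    ; closed  = closed′
    ; below   = below′
    ; size    = ≤-trans (n≤1+n _) (size inv)
    ; bounded = bounded inv
    }
    where
    ∉-∷ : ∀ {w} → w ≢ v → w ∉ p ∷ S → w ∉ v ∷ p ∷ S
    ∉-∷ w≢v w∉ (here w≡v) = w≢v w≡v
    ∉-∷ w≢v w∉ (there w∈) = w∉ w∈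
    closed′ : ∀ {w x} → Finished col (p ∷ S) w → adj G w x ≡ true → col x ≢ 0
    closed′ {w} (col-w≢0 , w∉) w-x with w ≟ᶠ v
    ... | yes refl = nbCount-zero G col v-done w-x
    ... | no w≢v   = closed inv (col-w≢0 , ∉-∷ w≢v w∉) w-x
    below′ : ∀ {w s} → Finished col (p ∷ S) w → s ∈ p ∷ S → adj G w s ≡ true → col s ≤ col w
    below′ {w} {s} (col-w≢0 , w∉) s∈ w-s with w ≟ᶠ v
    ... | yes refl = subst (col s ≤_) (sym (top-color inv))
                       (m≤n⇒m≤1+n (proj₂ (IsStack-colors (p ∷ S) (rest-IsStack inv) s∈)))
    ... | no w≢v   = below inv (col-w≢0 , ∉-∷ w≢v w∉) (there s∈) w-s

  push-invariant : ∀ {col v S u} → Invariant col S → col v ≡ 0 → Entering col S v →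
                   adj G v u ≡ true → update col v (suc (length S)) u ≡ 0 →
                   Invariant (update col v (suc (length S))) (v ∷ S)
  push-invariant {col} {v} {S} {u} inv col-v≡0 entering v-u u-uncolored = record
    { stack   = update-same col v _ , IsStack-cong S (update-misses-stack inv col-v≡0 _) (stack inv)
              , Entering⇒RestsOn S entering
    ; closed  = λ finished w-x → update-colored col v _ (closed inv (was-finished finished) w-x)
    ; below   = below′
    ; size    = ≤-trans (≤-reflexive (sym (+-suc (length S) _)))
                        (≤-trans (+-monoʳ-≤ (length S) U-drops) (size inv))
    ; bounded = bounded′
    }
    where
    col′ = update col v (suc (length S))
    U-drops = uncoloredCount-update col (length S) col-v≡0
    u-uncounted = uncoloredCount-pos col′ u-uncolored
    was-finished : ∀ {w} → Finished col′ (v ∷ S) w → Finished col S w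
    was-finished {w} (col′-w≢0 , w∉) =
      subst (_≢ 0) (update-other col _ (w∉ ∘ here)) col′-w≢0 , w∉ ∘ there
    below′ : ∀ {w s} → Finished col′ (v ∷ S) w → s ∈ v ∷ S → adj G w s ≡ true → col′ s ≤ col′ w
    below′ finished (here refl) w-v = ⊥-elim (closed inv (was-finished finished) w-v col-v≡0)
    below′ {w} {s} finished@(_ , w∉) (there s∈S) w-s =
      subst₂ _≤_ (update-misses-stack inv col-v≡0 _ s∈S) (sym (update-other col _ (w∉ ∘ here)))
        (below inv (was-finished finished) s∈S w-s)
    -- u and v are two distinct uncoloured vertices
    room : 2 + length S ≤ n
    room = begin
      2 + length S                   ≤⟨ +-monoˡ-≤ (length S) (≤-trans (s≤s u-uncounted) U-drops) ⟩
      uncoloredCount col + length S  ≡⟨ +-comm _ (length S) ⟩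
      length S + uncoloredCount col  ≤⟨ size inv ⟩
      n                              ∎
      where open ≤-Reasoning
    bounded′ : ∀ w → col′ w ≤ n ∸ 1
    bounded′ w with w ≟ᶠ v
    ... | yes _ = <⇒≤∸1 room
    ... | no _  = bounded inv w

  leaf-invariant : ∀ {col v p S} → Invariant col (p ∷ S) → col v ≡ 0 → nbCount G col v 0 ≡ 0 →
                   Invariant (update col v (suc (length S))) (p ∷ S)
  leaf-invariant {col} {v} {p} {S} inv col-v≡0 v-done = record
    { stack   = IsStack-cong (p ∷ S) (update-misses-stack inv col-v≡0 _) (stack inv)
    ; closed  = closed′
    ; below   = below′
    ; size    = ≤-trans (+-monoʳ-≤ (suc (length S)) (<⇒≤ (uncoloredCount-update col (length S) col-v≡0)))
                        (size inv)
    ; bounded = bounded′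
    }
    where
    col′ = update col v (suc (length S))
    closed′ : ∀ {w x} → Finished col′ (p ∷ S) w → adj G w x ≡ true → col′ x ≢ 0
    closed′ {w} (col′-w≢0 , w∉) w-x with w ≟ᶠ v
    ... | yes refl = update-colored col v _ (nbCount-zero G col v-done w-x)
    ... | no _     = update-colored col v _ (closed inv (col′-w≢0 , w∉) w-x)
    below′ : ∀ {w s} → Finished col′ (p ∷ S) w → s ∈ p ∷ S → adj G w s ≡ true → col′ s ≤ col′ w
    below′ {w} {s} (col′-w≢0 , w∉) s∈ w-s with w ≟ᶠ v
    ... | yes refl = subst (_≤ suc (length S)) (update-misses-stack inv col-v≡0 _ s∈)
                       (proj₂ (IsStack-colors (p ∷ S) (stack inv) s∈))
    ... | no _     = subst (_≤ col w) (update-misses-stack inv col-v≡0 _ s∈) (below inv (col′-w≢0 , w∉) s∈ w-s)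
    bounded′ : ∀ w → col′ w ≤ n ∸ 1
    bounded′ w with w ≟ᶠ v
    ... | yes _ = subst (_≤ n ∸ 1) (top-color inv) (bounded inv p)
    ... | no _  = bounded inv w

  data State (col : Coloring n) (v : Fin n) : Set where
    onTop    : ∀ S → Invariant col (v ∷ S) → State col v
    arriving : ∀ S → Invariant col S → col v ≡ 0 → Entering col S v → State col v

  potential : ∀ {col v} → State col v → ℕ
  potential {col} (onTop S _)        = 2 * uncoloredCount col + suc (suc (length S))
  potential {col} (arriving S _ _ _) = 2 * uncoloredCount col + length S

  State-cong : ∀ {col col′ v} → col ≗ col′ → (st : State col v) →
               Σ[ st′ ∈ State col′ v ] potential st′ ≡ potential st
  State-cong {col} {col′} {v} col≗col′ (onTop S inv) =
    onTop S (Invariant-cong col≗col′ inv) , cong (λ k → 2 * k + _) (sym (uncoloredCount-cong col≗col′))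
  State-cong {col} {col′} {v} col≗col′ (arriving S inv col-v≡0 entering) =
    arriving S (Invariant-cong col≗col′ inv) (trans (sym (col≗col′ v)) col-v≡0) (Entering-cong S entering) ,
    cong (λ k → 2 * k + _) (sym (uncoloredCount-cong col≗col′))
    where
    Entering-cong : ∀ S → Entering col S v → Entering col′ S v
    Entering-cong []      (all≡0 , v≡v₀) = (λ w → trans (sym (col≗col′ w)) (all≡0 w)) , v≡v₀
    Entering-cong (_ ∷ _) t-v            = t-v

  maxColorIn-arriving : ∀ {col S v} → Invariant col S → col v ≡ 0 → Entering col S v →
                        maxColorIn (envCounts G col v) ≡ length S
  maxColorIn-arriving {col} {S} {v} inv col-v≡0 entering =
    ≤-antisym (maxColorIn-least E on-stack) (top-seen S inv entering)
    where
    E = envCounts G col v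
    on-stack : ∀ {i} → 0 < countOf E (suc i) → suc i ≤ length S
    on-stack pos with nbCount-witness G col (subst (0 <_) (countOf-envAt G col v _) pos)
    ... | w , v-w , col-w = subst (_≤ length S) col-w
          (proj₂ (IsStack-colors S (stack inv) (coloredNbr-onStack inv col-v≡0 v-w (≡suc⇒≢0 col-w))))
    top-seen : ∀ S → Invariant col S → Entering col S v → length S ≤ maxColorIn E
    top-seen []      _   _   = z≤n
    top-seen (t ∷ S) inv t-v = maxColorIn-maximal E
      (subst (0 <_) (sym (countOf-envAt G col v _)) (nbCount-pos G col (adj-flip G t-v) (top-color inv)))

  dfsMove-envAt : ∀ col v → dfsMove (envAt G col v) ≡
            dfsDecision (col v) (nbCount G col v 0) (maxColorIn (envCounts G col v))
                        (nbCount G col v (pred (col v)))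
  dfsMove-envAt col v = cong₂ (λ a b → dfsDecision (col v) a (maxColorIn (envCounts G col v)) b)
                        (countOf-envAt G col v 0) (countOf-envAt G col v (pred (col v)))

  dfsMove-onTop : ∀ {col v S} → Invariant col (v ∷ S) → dfsMove (envAt G col v) ≡
               dfsDecision (suc (length S)) (nbCount G col v 0) (maxColorIn (envCounts G col v))
                           (nbCount G col v (length S))
  dfsMove-onTop {col} {v} inv =
    trans (dfsMove-envAt col v)
          (cong (λ c → dfsDecision c (nbCount G col v 0) m (nbCount G col v (pred c))) (top-color inv))
    where m = maxColorIn (envCounts G col v)

  dfsMove-arriving : ∀ {col v S} → Invariant col S → col v ≡ 0 → Entering col S v →
                  dfsMove (envAt G col v) ≡ dfsDecision 0 (nbCount G col v 0) (length S) (nbCount G col v 0)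
  dfsMove-arriving {col} {v} inv col-v≡0 entering =
    trans (dfsMove-envAt col v) (cong₂ (λ c m → dfsDecision c (nbCount G col v 0) m (nbCount G col v (pred c)))
                                 col-v≡0 (maxColorIn-arriving inv col-v≡0 entering))

  parent-of-top : ∀ {col v p S u} → Invariant col (v ∷ p ∷ S) → adj G v u ≡ true →
                  col u ≡ suc (length S) → u ≡ p
  parent-of-top {col} {v} {p} {S} {u} inv v-u col-u with u ∈? p ∷ S
  ... | yes u∈ = IsStack-top S (rest-IsStack inv) u∈ col-u
  ... | no u∉  = ⊥-elim (<-irrefl refl (subst₂ _≤_ (top-color inv) col-u
                   (below inv (≡suc⇒≢0 col-u , u∉′) (here refl) (adj-flip G v-u))))
    where
    u∉′ : u ∉ v ∷ p ∷ S
    u∉′ (here refl) = adj⇒≢ G v-u refl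
    u∉′ (there u∈)  = u∉ u∈

  parent-of-leaf : ∀ {col v p S u} → Invariant col (p ∷ S) → col v ≡ 0 → adj G v u ≡ true →
                   col u ≡ suc (length S) → u ≡ p
  parent-of-leaf inv col-v≡0 v-u col-u =
    IsStack-top _ (stack inv) (coloredNbr-onStack inv col-v≡0 v-u (≡suc⇒≢0 col-u)) col-u

  step-onTop : ∀ {col v S c₁ d u m} → (inv : Invariant col (v ∷ S)) →
               dfsDecision (suc (length S)) (nbCount G col v 0) m (nbCount G col v (length S)) ≡ Go c₁ d →
               adj G v u ≡ true → update col v c₁ u ≡ d →
               Σ[ st ∈ State col u ] potential st < potential (onTop S inv)
  step-onTop {col} {v} {S} inv move≡ v-u u≡d
    with nbCount G col v 0 in a≡ | nbCount G col v (length S) in b≡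
  step-onTop {col} {v} {S} inv refl v-u u≡0 | suc _ | _ =
    arriving (v ∷ S) inv (trans (sym (update-nbr G col v-u)) u≡0) v-u ,
    +-monoʳ-< (2 * uncoloredCount col) (n<1+n _)
  step-onTop {S = []}    inv () v-u u≡d | zero | _
  step-onTop {S = p ∷ S} inv () v-u u≡d | zero | zero
  step-onTop {col} {v} {p ∷ S} {u = u} inv refl v-u u≡ | zero | suc _
    with parent-of-top inv v-u (trans (sym (update-nbr G col v-u)) u≡)
  ... | refl = onTop S (pop-invariant inv a≡) , +-monoʳ-< (2 * uncoloredCount col) (n<1+n _)

  step-arriving : ∀ {col v S c₁ d u} (inv : Invariant col S) (col-v≡0 : col v ≡ 0)
                  (entering : Entering col S v) →
                  dfsDecision 0 (nbCount G col v 0) (length S) (nbCount G col v 0) ≡ Go c₁ d →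
                  adj G v u ≡ true → update col v c₁ u ≡ d →
                  Σ[ st ∈ State (update col v c₁) u ] potential st < potential (arriving S inv col-v≡0 entering)
  step-arriving {col} {v} {S} inv col-v≡0 entering move≡ v-u u≡d with nbCount G col v 0 in a≡
  step-arriving {col} {v} {S} inv col-v≡0 entering refl v-u u≡0 | suc _ =
    arriving (v ∷ S) (push-invariant inv col-v≡0 entering v-u u≡0) u≡0 v-u ,
    potential-drop (length S) (uncoloredCount-update col (length S) col-v≡0)
  step-arriving {S = []} inv col-v≡0 entering () v-u u≡d | zero
  step-arriving {col} {v} {p ∷ S} inv col-v≡0 entering refl v-u u≡ | zero
    with parent-of-leaf inv col-v≡0 v-u (trans (sym (update-nbr G col v-u)) u≡)
  ... | refl = onTop S (leaf-invariant inv col-v≡0 a≡) ,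
               potential-drop (suc (length S)) (uncoloredCount-update col (length S) col-v≡0)

  Done : Coloring n → Fin n → Set
  Done col v = v ≡ v₀ × (∀ w → col w ≢ 0 ⊎ w ≡ v₀)

  stop-onTop : Connected G → ∀ {col v S m} → Invariant col (v ∷ S) →
               dfsDecision (suc (length S)) (nbCount G col v 0) m (nbCount G col v (length S)) ≡ Stop → Done col v
  stop-onTop connected {col} {v} {S} inv move≡
    with nbCount G col v 0 in a≡ | nbCount G col v (length S) in b≡
  stop-onTop connected inv () | suc _ | _
  stop-onTop connected {col} {v} {[]} inv refl | zero  | _ =
    top-RestsOn inv ,
    λ w → inj₁ (Reach-closed G (λ x → col x ≢ 0) spread (connected v w) (≡suc⇒≢0 (top-color inv)))
    where
    spread : ∀ {x y} → col x ≢ 0 → adj G x y ≡ true → col y ≢ 0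
    spread {x} col-x≢0 x-y with x ≟ᶠ v
    ... | yes refl = nbCount-zero G col a≡ x-y
    ... | no x≢v   = closed inv (col-x≢0 , λ { (here x≡v) → x≢v x≡v }) x-y
  stop-onTop connected {col} {v} {p ∷ S} inv refl | zero | zero =
    ⊥-elim (<-irrefl refl (subst (0 <_) b≡ (nbCount-pos G col (top-RestsOn inv) (proj₁ (rest-IsStack inv)))))
  stop-onTop connected {S = p ∷ S} inv () | zero | suc _

  stop-arriving : Connected G → ∀ {col v S} → Invariant col S → col v ≡ 0 → Entering col S v →
                  dfsDecision 0 (nbCount G col v 0) (length S) (nbCount G col v 0) ≡ Stop → Done col v
  stop-arriving connected {col} {v} {S} inv col-v≡0 entering move≡ with nbCount G col v 0 in a≡
  stop-arriving connected           inv col-v≡0 entering                ()   | suc _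
  stop-arriving connected {S = _ ∷ _} inv col-v≡0 entering              ()   | zero
  stop-arriving connected {col} {S = []} inv col-v≡0 (uncolored , refl) refl | zero =
    refl , λ w → inj₂ (Reach-closed G (_≡ v₀) isolated (connected v₀ w) refl)
    where
    isolated : ∀ {x y} → x ≡ v₀ → adj G x y ≡ true → y ≡ v₀
    isolated refl x-y = ⊥-elim (nbCount-zero G col a≡ x-y (uncolored _))

  keeps-color : ∀ {col v c₁ d} → col v ≢ 0 → dfsMove (envAt G col v) ≡ Go c₁ d → col ≗ update col v c₁
  keeps-color {col} {v} col-v≢0 move≡ =
    update-id col (sym (proj₂ (subst (ValidDecision (envAt G col v)) move≡ (dfsMove-valid _)) col-v≢0))

  advance : ∀ {col v c₁ d u} (st : State col v) → dfsMove (envAt G col v) ≡ Go c₁ d →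
            adj G v u ≡ true → update col v c₁ u ≡ d →
            Σ[ st′ ∈ State (update col v c₁) u ] potential st′ < potential st
  advance {col} (onTop S inv) move≡ v-u u≡d
    with step-onTop inv (trans (sym (dfsMove-onTop inv)) move≡) v-u u≡d
  ... | st , drop with State-cong (keeps-color (≡suc⇒≢0 (top-color inv)) move≡) st
  ...   | st′ , same = st′ , subst (_< _) (sym same) drop
  advance (arriving S inv col-v≡0 entering) move≡ =
    step-arriving inv col-v≡0 entering (trans (sym (dfsMove-arriving inv col-v≡0 entering)) move≡)

  stop : Connected G → ∀ {col v} → State col v → dfsMove (envAt G col v) ≡ Stop → Done col v
  stop connected (onTop S inv) move≡ =
    stop-onTop connected inv (trans (sym (dfsMove-onTop inv)) move≡)
  stop connected (arriving S inv col-v≡0 entering) move≡ =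
    stop-arriving connected inv col-v≡0 entering (trans (sym (dfsMove-arriving inv col-v≡0 entering)) move≡)

  State-bounded : ∀ {col v} → State col v → ∀ w → col w ≤ n ∸ 1
  State-bounded (onTop _ inv)        = bounded inv
  State-bounded (arriving _ inv _ _) = bounded inv

  initial : State uncolored v₀
  initial = arriving [] invariant refl ((λ _ → refl) , refl)
    where
    invariant : Invariant uncolored []
    invariant = record
      { stack   = tt
      ; closed  = λ (0≢0 , _) → ⊥-elim (0≢0 refl)
      ; below   = λ (0≢0 , _) → ⊥-elim (0≢0 refl)
      ; size    = uncoloredCount-≤ uncolored
      ; bounded = λ _ → z≤n
      }

  reachable-state : ∀ {col v} → Reachable dfs G v₀ col v → State col v
  reachable-state start                  = initial
  reachable-state (step r move≡ v-u u≡d) = proj₁ (advance (reachable-state r) move≡ v-u u≡d)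

  explores : Connected G → ∀ N {col vis v} (st : State col v) → potential st < N →
             (∀ w → col w ≢ 0 → vis w ≡ true) → vis v ≡ true → GoodFrom dfs G v₀ col vis v
  explores connected (suc N) {col} {vis} {v} st bound colored⇒visited visited-v
    with dfsMove (envAt G col v) in move≡
  ... | Stop with stop connected st move≡
  ...   | refl , covered = done move≡ (λ w → [ colored⇒visited w , (λ { refl → visited-v }) ] (covered w)) refl
  explores connected (suc N) {col} {vis} {v} st bound colored⇒visited visited-v | Go c₁ d = step move≡ next
    where
    next : ∀ u → adj G v u ≡ true → update col v c₁ u ≡ d →
           GoodFrom dfs G v₀ (update col v c₁) (mark vis u) u
    next u v-u u≡d with advance st move≡ v-u u≡d
    ... | st′ , drop =
      explores connected N st′ (<-≤-trans drop (s≤s⁻¹ bound)) colored⇒visited′ (mark-same vis u)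
      where
      colored⇒visited′ : ∀ w → update col v c₁ w ≢ 0 → mark vis u w ≡ true
      colored⇒visited′ w col′-w≢0 with w ≟ᶠ v
      ... | yes refl = mark-mono vis u visited-v
      ... | no _     = mark-mono vis u (colored⇒visited w col′-w≢0)

theorem3 : Σ Algorithm (λ A → (n : ℕ) (G : Graph n) → Connected G →
             SuccessfullyExplores A G × UsesAtMost A G (n ∸ 1))
theorem3 = dfs , λ n G connected →
  (λ v₀ → explores G v₀ connected _ (initial G v₀) (n<1+n _)
                   (λ _ 0≢0 → ⊥-elim (0≢0 refl)) (mark-same _ v₀)) ,
  (λ v₀ col v reachable → usedColors-≤ col (State-bounded G v₀ (reachable-state G v₀ reachable)))
  where open DepthFirstSearch
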